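{- (i) Let $n\ge 3$ be an integer and $t$ an arbitrary integer. Define \[ x_1=x_2=\cdots=x_{n-2}=8t(t^2+1)(t^2-1),\quad x_{n-1}=(t^2-1)\{(n-2)t^4+(2n-20)t^2+n-2\},\quad x_n=2t\{(n-6)t^4+(2n+4)t^2+n-6\}. \] Then for each $j\in\{1,\dots,n\}$, the sum $\sum_{i\ne j}x_i^2$ is a perfect square. (ii) Let $m\ge 2$ be an integer, $n=m^2+1$, and $t$ an arbitrary integer. Define $x_1=x_2=\cdots=x_{n-1}=2t$ and $x_n=(n-2)t^2-1$. Then for each $j\in\{1,\dots,n\}$, the sum $\sum_{i\ne j}x_i^2$ is a perfect square. -}

module Defs where

open import Data.Nat as ℕ using (ℕ)
open import Data.Fin using (Fin; toℕ; _≟_)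
open import Data.Integer using (ℤ; +_; _+_; _-_; _*_; 0ℤ)
open import Data.Product using (∃)
open import Data.Bool using (if_then_else_)
open import Data.List using (foldr; map; allFin)
open import Relation.Binary.PropositionalEquality using (_≡_)
open import Relation.Nullary.Decidable using (does)

IsSquare : ℤ → Set
IsSquare s = ∃ λ (k : ℤ) → k * k ≡ s

sumSqExcept : {n : ℕ} → (Fin n → ℤ) → Fin n → ℤ
sumSqExcept {n} x j =
  foldr _+_ 0ℤ (map (λ i → if does (i ≟ j) then 0ℤ else x i * x i) (allFin n))

-- Indices are 0-based: paper's x_k is index k-1.
-- part (i): x_1..x_{n-2} (indices < n-2) = 8t(t^2+1)(t^2-1),
-- x_{n-1} (index n-2) = (t^2-1)((n-2)t^4+(2n-20)t^2+n-2),
-- x_n (index n-1) = 2t((n-6)t^4+(2n+4)t^2+n-6).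
xA : (n : ℕ) → ℤ → Fin n → ℤ
xA n t i =
  if does (toℕ i ℕ.<? (n ℕ.∸ 2))
  then + 8 * t * (t * t + + 1) * (t * t - + 1)
  else (if does (toℕ i ℕ.≟ (n ℕ.∸ 2))
        then (t * t - + 1) * ((+ n - + 2) * (t * t * t * t) + (+ 2 * + n - + 20) * (t * t) + (+ n - + 2))
        else + 2 * t * ((+ n - + 6) * (t * t * t * t) + (+ 2 * + n + + 4) * (t * t) + (+ n - + 6)))

xB : (n : ℕ) → ℤ → Fin n → ℤ
xB n t i =
  if does (toℕ i ℕ.<? (n ℕ.∸ 1))
  then + 2 * t
  else (+ n - + 2) * (t * t) - + 1

-- Each x_i takes one of only two or three values, so the full sum of squares S has a closed form
-- and S − x_j² only depends on which value x_j takes.  For each value, S − x_j² is the square of an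
-- explicit polynomial: in (i) this is a polynomial identity in n and t; in (ii), with v = (n−2)t² − 1,
-- one has (n−2)(2t)² = 4(v+1), so S − (2t)² = (v+2)², while S − v² = (n−1)(2t)² = (2mt)².

module Submission where

open import Defs
open import Data.Nat using (ℕ; zero; suc; _≤_; _<_; _<?_; s≤s)
import Data.Nat as ℕ
import Data.Nat.Properties as ℕP
open import Data.Integer using (ℤ; +_; 0ℤ; _+_; _-_; _*_)
import Data.Integer.Properties as ℤP
open import Data.Integer.Tactic.RingSolver using (solve; solve-∀)
open import Data.Fin using (Fin; zero; suc; toℕ; _≟_)
open import Data.Fin.Properties using (toℕ-inject₁; toℕ-fromℕ)
open import Data.Vec.Functional using (Vector)
open import Data.Product using (_×_; _,_)
open import Data.Bool using (true; false; if_then_else_)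
open import Data.List using ([]; _∷_; foldr; map; allFin; tabulate)
open import Data.List.Properties using (map-tabulate)
open import Relation.Nullary.Decidable using (does; dec-true; dec-false)
open import Relation.Binary.PropositionalEquality
open import Function using (_∘_; id)
open import Algebra.Properties.Monoid.Sum ℤP.+-0-monoid using (sum; sum-init-last; sum-cong-≗)

open ≡-Reasoning

if-elim : ∀ {a p} {A : Set a} (P : A → Set p) b {x y : A} → P x → P y → P (if b then x else y)
if-elim P true  px py = px
if-elim P false px py = py

foldr-tabulate : ∀ {n} (f : Vector ℤ n) → foldr _+_ 0ℤ (tabulate f) ≡ sum f
foldr-tabulate {zero}  f = refl
foldr-tabulate {suc n} f = cong (_+_ (f zero)) (foldr-tabulate (f ∘ suc))

foldr-map-allFin : ∀ {n} (f : Vector ℤ n) → foldr _+_ 0ℤ (map f (allFin n)) ≡ sum f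
foldr-map-allFin f = trans (cong (foldr _+_ 0ℤ) (map-tabulate id f)) (foldr-tabulate f)

sum-punctured-+ : ∀ {n} (f : Vector ℤ n) j → sum (λ i → if does (i ≟ j) then 0ℤ else f i) + f j ≡ sum f
sum-punctured-+ {suc n} f zero =
  trans (cong (_+ f zero) (ℤP.+-identityˡ (sum (f ∘ suc)))) (ℤP.+-comm (sum (f ∘ suc)) (f zero))
sum-punctured-+ {suc n} f (suc j) =
  trans (ℤP.+-assoc (f zero) _ _) (cong (_+_ (f zero)) (sum-punctured-+ (f ∘ suc) j))

sumSqExcept≡ : ∀ {n} (x : Vector ℤ n) j → sumSqExcept x j ≡ sum (λ i → x i * x i) - x j * x j
sumSqExcept≡ x j = begin
  sumSqExcept x j                           ≡⟨ add-sub (sumSqExcept x j) (x j * x j) ⟩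
  sumSqExcept x j + x j * x j - x j * x j   ≡⟨ cong (λ s → s + x j * x j - x j * x j)
                                                    (foldr-map-allFin (λ i → if does (i ≟ j) then 0ℤ else x i * x i)) ⟩
  sum (λ i → if does (i ≟ j) then 0ℤ else x i * x i) + x j * x j - x j * x j
                                            ≡⟨ cong (_- x j * x j) (sum-punctured-+ (λ i → x i * x i) j) ⟩
  sum (λ i → x i * x i) - x j * x j         ∎
  where
  add-sub : ∀ a b → a ≡ a + b - b
  add-sub = solve-∀

IsSquare-sumSqExcept : ∀ {n} (x : Vector ℤ n) {S} → sum (λ i → x i * x i) ≡ S →
                       ∀ j → IsSquare (S - x j * x j) → IsSquare (sumSqExcept x j)
IsSquare-sumSqExcept x refl j = subst IsSquare (sym (sumSqExcept≡ x j))

sum-toℕ-snoc : ∀ n (h : ℕ → ℤ) → sum {suc n} (h ∘ toℕ) ≡ sum {n} (h ∘ toℕ) + h n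
sum-toℕ-snoc n h = trans (sum-init-last {n} (h ∘ toℕ))
  (cong₂ _+_ (sum-cong-≗ {n} (cong h ∘ toℕ-inject₁)) (cong h (toℕ-fromℕ n)))

sum-toℕ-constant : ∀ n (h : ℕ → ℤ) {a} → (∀ {k} → k < n → h k ≡ a) → sum {n} (h ∘ toℕ) ≡ + n * a
sum-toℕ-constant zero    h ha = refl
sum-toℕ-constant (suc n) h {a} ha = begin
  sum {suc n} (h ∘ toℕ)     ≡⟨ sum-toℕ-snoc n h ⟩
  sum {n} (h ∘ toℕ) + h n   ≡⟨ cong₂ _+_ (sum-toℕ-constant n h (ha ∘ ℕP.m<n⇒m<1+n)) (ha (ℕP.n<1+n n)) ⟩
  + n * a + a               ≡⟨ ℤP.+-comm (+ n * a) a ⟩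
  a + + n * a               ≡⟨ ℤP.suc-* (+ n) a ⟨
  + suc n * a               ∎

-- xB (1 + q) t and xA (2 + p) t are definitionally of the form step₂ q u v ∘ toℕ and step₃ p a b c ∘ toℕ.
step₂ : ℕ → ℤ → ℤ → ℕ → ℤ
step₂ q u v k = if does (k <? q) then u else v

step₃ : ℕ → ℤ → ℤ → ℤ → ℕ → ℤ
step₃ p a b c k = if does (k <? p) then a else (if does (k ℕ.≟ p) then b else c)

sum-squares-step₂ : ∀ q u v →
  sum {suc q} (λ i → step₂ q u v (toℕ i) * step₂ q u v (toℕ i)) ≡ + q * (u * u) + v * v
sum-squares-step₂ q u v = begin
  sum {suc q} (square ∘ toℕ)   ≡⟨ sum-toℕ-snoc q square ⟩
  sum {q} (square ∘ toℕ) + square q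
    ≡⟨ cong₂ _+_ (sum-toℕ-constant q square (λ {k} k<q → cong (λ x → x * x) (below k<q)))
                 (cong (λ x → x * x) at) ⟩
  + q * (u * u) + v * v        ∎
  where
  square : ℕ → ℤ
  square k = step₂ q u v k * step₂ q u v k
  below : ∀ {k} → k < q → step₂ q u v k ≡ u
  below {k} k<q = cong (if_then u else v) (dec-true (k <? q) k<q)
  at : step₂ q u v q ≡ v
  at = cong (if_then u else v) (dec-false (q <? q) (ℕP.n≮n q))

sum-squares-step₃ : ∀ p a b c →
  sum {suc (suc p)} (λ i → step₃ p a b c (toℕ i) * step₃ p a b c (toℕ i)) ≡ + p * (a * a) + b * b + c * c
sum-squares-step₃ p a b c = begin
  sum {suc (suc p)} (square ∘ toℕ)              ≡⟨ sum-toℕ-snoc (suc p) square ⟩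
  sum {suc p} (square ∘ toℕ) + square (suc p)   ≡⟨ cong (_+ square (suc p)) (sum-toℕ-snoc p square) ⟩
  sum {p} (square ∘ toℕ) + square p + square (suc p)
    ≡⟨ cong₂ _+_ (cong₂ _+_ (sum-toℕ-constant p square (λ {k} k<p → cong (λ x → x * x) (below k<p)))
                            (cong (λ x → x * x) at))
                 (cong (λ x → x * x) after) ⟩
  + p * (a * a) + b * b + c * c                 ∎
  where
  square : ℕ → ℤ
  square k = step₃ p a b c k * step₃ p a b c k
  rest : ℕ → ℤ
  rest k = if does (k ℕ.≟ p) then b else c
  below : ∀ {k} → k < p → step₃ p a b c k ≡ a
  below {k} k<p = cong (λ d → if d then a else rest k) (dec-true (k <? p) k<p)
  at : step₃ p a b c p ≡ b
  at = begin
    step₃ p a b c p   ≡⟨ cong (λ d → if d then a else rest p) (dec-false (p <? p) (ℕP.n≮n p)) ⟩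
    rest p            ≡⟨ cong (if_then b else c) (dec-true (p ℕ.≟ p) refl) ⟩
    b                 ∎
  after : step₃ p a b c (suc p) ≡ c
  after = begin
    step₃ p a b c (suc p) ≡⟨ cong (λ d → if d then a else rest (suc p))
                                   (dec-false (suc p <? p) (ℕP.<-asym (ℕP.n<1+n p))) ⟩
    rest (suc p)          ≡⟨ cong (if_then b else c) (dec-false (suc p ℕ.≟ p) ℕP.1+n≢n) ⟩
    c                     ∎

IsSquare-sumSqExcept-step₂ : ∀ q u v →
  let S = + q * (u * u) + v * v
  in  IsSquare (S - u * u) × IsSquare (S - v * v) →
      (j : Fin (suc q)) → IsSquare (sumSqExcept (step₂ q u v ∘ toℕ) j)
IsSquare-sumSqExcept-step₂ q u v (□u , □v) j =
  IsSquare-sumSqExcept {suc q} (step₂ q u v ∘ toℕ) (sum-squares-step₂ q u v) j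
    (if-elim (λ x → IsSquare (+ q * (u * u) + v * v - x * x)) (does (toℕ j <? q)) □u □v)

IsSquare-sumSqExcept-step₃ : ∀ p a b c →
  let S = + p * (a * a) + b * b + c * c
  in  IsSquare (S - a * a) × IsSquare (S - b * b) × IsSquare (S - c * c) →
      (j : Fin (suc (suc p))) → IsSquare (sumSqExcept (step₃ p a b c ∘ toℕ) j)
IsSquare-sumSqExcept-step₃ p a b c (□a , □b , □c) j =
  IsSquare-sumSqExcept {suc (suc p)} (step₃ p a b c ∘ toℕ) (sum-squares-step₃ p a b c) j
    (if-elim P (does (toℕ j <? p)) □a (if-elim P (does (toℕ j ℕ.≟ p)) □b □c))
  where
  P : ℤ → Set
  P x = IsSquare (+ p * (a * a) + b * b + c * c - x * x)

-- N stands for n and P for n − 2; writing N as 2 + P makes the values agree with xA (2 + p) on the nose.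
removal-squares-I : ∀ P t →
  let N = + 2 + P
      a = + 8 * t * (t * t + + 1) * (t * t - + 1)
      b = (t * t - + 1) * ((N - + 2) * (t * t * t * t) + (+ 2 * N - + 20) * (t * t) + (N - + 2))
      c = + 2 * t * ((N - + 6) * (t * t * t * t) + (+ 2 * N + + 4) * (t * t) + (N - + 6))
      S = P * (a * a) + b * b + c * c
  in  IsSquare (S - a * a) × IsSquare (S - b * b) × IsSquare (S - c * c)
removal-squares-I P t =
  (P * (t * t + + 1) * (t * t + + 1) * (t * t + + 1) , solve (P ∷ t ∷ [])) ,
  (t * ((+ 2 * P + + 8) * (t * t * t * t) + (+ 4 * P - + 16) * (t * t) + (+ 2 * P + + 8)) , solve (P ∷ t ∷ [])) ,
  (P * (t * t * t * t * t * t) + (P + + 16) * (t * t * t * t) - (P + + 16) * (t * t) - P , solve (P ∷ t ∷ []))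

-- Here Q stands for n − 1 = m², and N = 1 + Q for n.
removal-squares-II : ∀ Q M t → Q ≡ M * M →
  let N = + 1 + Q
      u = + 2 * t
      v = (N - + 2) * (t * t) - + 1
      S = Q * (u * u) + v * v
  in  IsSquare (S - u * u) × IsSquare (S - v * v)
removal-squares-II Q M t Q≡M² =
  ((+ 1 + Q - + 2) * (t * t) + + 1 , solve (Q ∷ t ∷ [])) ,
  (M * u , trans (scaled-square M u v) (cong (λ k → k * (u * u) + v * v - v * v) (sym Q≡M²)))
  where
  u v : ℤ
  u = + 2 * t
  v = (+ 1 + Q - + 2) * (t * t) - + 1
  scaled-square : ∀ M x y → (M * x) * (M * x) ≡ M * M * (x * x) + y * y - y * y
  scaled-square = solve-∀

lemma3 : ((n : ℕ) → 3 ≤ n → (t : ℤ) → (j : Fin n) → IsSquare (sumSqExcept (xA n t) j))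
       × ((m n : ℕ) → 2 ≤ m → n ≡ m ℕ.* m ℕ.+ 1 → (t : ℤ) → (j : Fin n) → IsSquare (sumSqExcept (xB n t) j))
lemma3 = partI , partII
  where
  partI : (n : ℕ) → 3 ≤ n → (t : ℤ) → (j : Fin n) → IsSquare (sumSqExcept (xA n t) j)
  partI (suc (suc p)) (s≤s (s≤s _)) t = IsSquare-sumSqExcept-step₃ p _ _ _ (removal-squares-I (+ p) t)

  partII : (m n : ℕ) → 2 ≤ m → n ≡ m ℕ.* m ℕ.+ 1 → (t : ℤ) → (j : Fin n) → IsSquare (sumSqExcept (xB n t) j)
  partII m n _ n≡m²+1 t with trans n≡m²+1 (ℕP.+-comm (m ℕ.* m) 1)
  ... | refl = IsSquare-sumSqExcept-step₂ (m ℕ.* m) _ _ (removal-squares-II (+ (m ℕ.* m)) (+ m) t (ℤP.pos-* m m))
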